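{- Let $S$ and $T$ be non-empty ordered trees and let $d>0$ be a natural number. Then there exists a non-empty ordered tree $V$ with $\mathrm{br}(V)=\mathrm{br}(T)$ such that for each $d$-coloring of the set of all leaf preserving embeddings from $S$ to $V$ there is a leaf preserving embedding $g_0\colon T\to V$ such that the set \[ \{ g_0\circ f\colon f\colon S\to T \text{ a leaf preserving embedding}\} \] is monochromatic.
   Context: A tree is a finite, possibly empty, partial order in which any two elements have a common predecessor and the set of predecessors of each element is linearly ordered; every node counts as its own predecessor and its own successor. A non-empty tree has a smallest element (the root); maximal elements are leaves. For $v,w$ in a tree $T$, $v\wedge_T w$ is the largest common predecessor of $v$ and $w$. A function $f\colon S\to T$ between trees is a morphism if $f(v\wedge_S w)=f(v)\wedge_T f(w)$ for all $v,w\in S$. For $v\in T$, $\mathrm{im}_T(v)$ is the set of immediate successors of $v$ (not including $v$), and for non-empty $T$, $\mathrm{br}(T)=\max_{v\in T}|\mathrm{im}_T(v)|$. A tree is ordered if for each $v$ a linear order on $\mathrm{im}(v)$ is fixed; this induces the lexicographic linear order $\leq_T$ on $T$: $v\leq_T w$ if $v$ is a predecessor of $w$, and if $v,w$ are incomparable in the tree, $v\leq_T w$ iff the predecessor of $v$ in $\mathrm{im}(v\wedge w)$ is less than or equal to the predecessor of $w$ in $\mathrm{im}(v\wedge w)$ in the given order. An embedding from an ordered tree $S$ to an ordered tree $T$ is an injective tree morphism $f\colon S\to T$ such that (i) $f$ is order preserving from $\leq_S$ to $\leq_T$, and (ii) for each $v\in S$, the set of $w\in \mathrm{im}_T(f(v))$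 that are predecessors of $f(v')$ for some $v'\in \mathrm{im}_S(v)$ forms an initial segment of $\mathrm{im}_T(f(v))$ with respect to $\leq_T$. An embedding is leaf preserving if it maps each leaf of its domain to a leaf of its range. A $d$-coloring of a set is a function from it to a $d$-element set; a subset is monochromatic if the coloring is constant on it. -}

module Defs where

open import Data.Nat using (ℕ; zero; suc; _<_; _≤_; _⊔_; _≟_)
open import Data.List using (List; []; _∷_; _++_; _∷ʳ_; length; foldr; map)
open import Data.Maybe using (Maybe; just; nothing)
open import Data.Product using (Σ; ∃; _×_; _,_)
open import Data.Bool using (if_then_else_)
open import Relation.Nullary.Decidable using (⌊_⌋)
open import Relation.Binary.PropositionalEquality using (_≡_)

-- A non-empty finite ordered tree: a rose tree.  The immediate successors of
-- a node are its children, ordered by their position in the list.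
data Tree : Set where
  node : List Tree → Tree

-- Nodes of a tree are addressed by paths from the root: lists of child indices.
Addr : Set
Addr = List ℕ

mutual
  sub : Tree → Addr → Maybe Tree
  sub t [] = just t
  sub (node ts) (i ∷ a) = subF ts i a

  subF : List Tree → ℕ → Addr → Maybe Tree
  subF [] i a = nothing
  subF (t ∷ ts) zero a = sub t a
  subF (t ∷ ts) (suc i) a = subF ts i a

_∈ᵀ_ : Addr → Tree → Set
a ∈ᵀ t = ∃ λ u → sub t a ≡ just u

IsLeaf : Tree → Addr → Set
IsLeaf t a = sub t a ≡ just (node [])

mutual
  nodes : Tree → List Addr
  nodes (node ts) = [] ∷ nodesF 0 ts

  nodesF : ℕ → List Tree → List Addr
  nodesF i [] = []
  nodesF i (t ∷ ts) = map (i ∷_) (nodes t) ++ nodesF (suc i) ts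

mutual
  br : Tree → ℕ
  br (node ts) = length ts ⊔ brF ts

  brF : List Tree → ℕ
  brF [] = 0
  brF (t ∷ ts) = br t ⊔ brF ts

_≼_ : Addr → Addr → Set
a ≼ b = ∃ λ c → a ++ c ≡ b

_∧_ : Addr → Addr → Addr
[] ∧ b = []
(i ∷ a) ∧ [] = []
(i ∷ a) ∧ (j ∷ b) = if ⌊ i ≟ j ⌋ then i ∷ (a ∧ b) else []

data _≤ˡ_ : Addr → Addr → Set where
  []≤ : ∀ {b} → [] ≤ˡ b
  <≤  : ∀ {i j a b} → i < j → (i ∷ a) ≤ˡ (j ∷ b)
  ≡≤  : ∀ {i a b} → a ≤ˡ b → (i ∷ a) ≤ˡ (i ∷ b)

record IsEmbedding (S V : Tree) (f : Addr → Addr) : Set where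
  field
    maps-to : ∀ a → a ∈ᵀ S → f a ∈ᵀ V
    injective : ∀ a b → a ∈ᵀ S → b ∈ᵀ S → f a ≡ f b → a ≡ b
    morphism : ∀ a b → a ∈ᵀ S → b ∈ᵀ S → f (a ∧ b) ≡ f a ∧ f b
    order-preserving : ∀ a b → a ∈ᵀ S → b ∈ᵀ S → a ≤ˡ b → f a ≤ˡ f b
    -- (ii): the immediate successors of f v lying below the image of some
    -- immediate successor of v form an initial segment of im_V(f v)
    initial-segment : ∀ v → v ∈ᵀ S → ∀ j k → j ≤ k → (f v ∷ʳ k) ∈ᵀ V →
      (Σ ℕ λ i → (v ∷ʳ i) ∈ᵀ S × (f v ∷ʳ k) ≼ f (v ∷ʳ i)) →
      Σ ℕ λ i → (v ∷ʳ i) ∈ᵀ S × (f v ∷ʳ j) ≼ f (v ∷ʳ i)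

record IsLPEmbedding (S V : Tree) (f : Addr → Addr) : Set where
  field
    embedding : IsEmbedding S V f
    leaf-preserving : ∀ a → IsLeaf S a → IsLeaf V (f a)

-- the embedding f : S → V as a concrete object: its table of values on the
-- (enumerated) nodes of S.  Two embeddings are equal iff their tables are.
table : Tree → (Addr → Addr) → List Addr
table S f = map f (nodes S)

module Submission where

-- Let b = br T, which is positive unless T is a single node (a trivial case).  Leaf
-- preserving embeddings of S into the complete b-ary tree of height K are described by
-- finite codes, on which the embeddings between complete trees act by composition.  For
-- these codes a Ramsey theorem holds; for tuples of trees it is proved by induction on
-- their total size, reducing the colour of an embedding of the first tree to a colour of
-- the position of its root, which a pigeonhole argument makes constant.  Finally T is
-- coded once into a complete tree V.  Every leaf preserving f : S → T followed by this
-- code is again a code of S, so a copy of T in V on which all codes of S have one colour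
-- gives the required g₀.

open import Defs
open import Data.Bool using (Bool; true; false; not)
open import Data.Bool.Properties using (¬-not) renaming (_≟_ to _≟ᵇ_)
open import Data.Empty using (⊥-elim)
open import Data.Fin using (Fin; zero; suc; toℕ; fromℕ<)
open import Data.Fin.Properties using (toℕ<n; toℕ-fromℕ<)
open import Data.List using (List; []; _∷_; _++_; _∷ʳ_; length; replicate)
open import Data.List.Properties
  using (++-assoc; ++-identityʳ; ++-identityʳ-unique; ++-cancelˡ; ∷-injective; length-replicate; map-cong-local)
open import Data.List.Relation.Unary.All as All using (All; []; _∷_)
open import Data.List.Relation.Unary.All.Properties using (++⁺; gmap⁺)
open import Data.Maybe using (just)
open import Data.Nat using (ℕ; zero; suc; pred; _+_; _⊔_; _≤_; _<_; z≤n; s≤s; _≤?_; >-nonZero)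
open import Data.Nat.Properties
  using (_≟_; ≤-refl; ≤-trans; ≤-reflexive; ≤-irrelevant; <-irrefl; <-trans; <⇒≢; ≤-<-trans; <-cmp; n<1+n; n≤1+n;
         m≤n⇒m≤1+n; +-identityʳ; +-suc; +-assoc; suc-injective; m≤m⊔n; m≤n⊔m; ⊔-lub; m≥n⇒m⊔n≡m; suc-pred)
open import Data.Product using (Σ; _×_; _,_; proj₁; proj₂)
open import Data.Sum using (_⊎_; inj₁; inj₂; swap)
open import Function using (_∘_; id)
open import Relation.Binary using (tri<; tri≈; tri>)
open import Relation.Binary.PropositionalEquality
  using (_≡_; _≢_; refl; sym; trans; cong; cong₂; subst; subst₂; module ≡-Reasoning)
open import Relation.Nullary using (yes; no)

∧-∷-≡ : ∀ i a b → (i ∷ a) ∧ (i ∷ b) ≡ i ∷ (a ∧ b)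
∧-∷-≡ i a b with i ≟ i
... | yes _ = refl
... | no i≢i = ⊥-elim (i≢i refl)

∧-∷-≢ : ∀ {i j} a b → i ≢ j → (i ∷ a) ∧ (j ∷ b) ≡ []
∧-∷-≢ {i} {j} a b i≢j with i ≟ j
... | yes i≡j = ⊥-elim (i≢j i≡j)
... | no _ = refl

∧-++ : ∀ a x y → (a ++ x) ∧ (a ++ y) ≡ a ++ (x ∧ y)
∧-++ [] x y = refl
∧-++ (i ∷ a) x y = trans (∧-∷-≡ i (a ++ x) (a ++ y)) (cong (i ∷_) (∧-++ a x y))

a∧a++x≡a : ∀ a x → a ∧ (a ++ x) ≡ a
a∧a++x≡a [] x = refl
a∧a++x≡a (i ∷ a) x = trans (∧-∷-≡ i a (a ++ x)) (cong (i ∷_) (a∧a++x≡a a x))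

∧-siblings : ∀ a {i j} → i ≢ j → (a ∷ʳ i) ∧ (a ∷ʳ j) ≡ a
∧-siblings a {i} {j} i≢j = begin
  (a ++ i ∷ []) ∧ (a ++ j ∷ []) ≡⟨ ∧-++ a (i ∷ []) (j ∷ []) ⟩
  a ++ (i ∷ []) ∧ (j ∷ [])      ≡⟨ cong (a ++_) (∧-∷-≢ [] [] i≢j) ⟩
  a ++ []                       ≡⟨ ++-identityʳ a ⟩
  a                             ∎
  where open ≡-Reasoning

a∧b≡a⇒a≼b : ∀ a b → a ∧ b ≡ a → a ≼ b
a∧b≡a⇒a≼b [] b _ = b , refl
a∧b≡a⇒a≼b (i ∷ a) [] ()
a∧b≡a⇒a≼b (i ∷ a) (j ∷ b) eq with i ≟ j | eq
... | no _ | ()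
... | yes refl | eq′ with a∧b≡a⇒a≼b a b (proj₂ (∷-injective eq′))
... | c , a++c≡b = c , cong (i ∷_) a++c≡b

≼-trans : ∀ {a b c} → a ≼ b → b ≼ c → a ≼ c
≼-trans {a} (x , refl) (y , refl) = x ++ y , sym (++-assoc a x y)

≼-∷⁺ : ∀ i {a b} → a ≼ b → (i ∷ a) ≼ (i ∷ b)
≼-∷⁺ i (x , p) = x , cong (i ∷_) p

≼-∷⁻ : ∀ {i a b} → (i ∷ a) ≼ (i ∷ b) → a ≼ b
≼-∷⁻ (x , p) = x , proj₂ (∷-injective p)

a++k∷w≢a : ∀ (a : Addr) k w → a ++ (k ∷ w) ≢ a
a++k∷w≢a a k w eq with ++-identityʳ-unique a (sym eq)
... | ()

≼∧≢⇒child : ∀ a b → a ≼ b → b ≢ a → Σ ℕ λ k → Σ Addr λ w → b ≡ a ++ (k ∷ w)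
≼∧≢⇒child a b ([] , p) b≢a = ⊥-elim (b≢a (trans (sym p) (++-identityʳ a)))
≼∧≢⇒child a b ((k ∷ w) , p) _ = k , w , sym p

++-∷ : ∀ (a : Addr) k w → a ++ (k ∷ w) ≡ (a ∷ʳ k) ++ w
++-∷ a k w = sym (++-assoc a (k ∷ []) w)

≤ˡ-++⁺ : ∀ a {x y} → x ≤ˡ y → (a ++ x) ≤ˡ (a ++ y)
≤ˡ-++⁺ [] le = le
≤ˡ-++⁺ (i ∷ a) le = ≡≤ (≤ˡ-++⁺ a le)

≤ˡ-++⁻ : ∀ a {x y} → (a ++ x) ≤ˡ (a ++ y) → x ≤ˡ y
≤ˡ-++⁻ [] le = le
≤ˡ-++⁻ (i ∷ a) (<≤ i<i) = ⊥-elim (<-irrefl refl i<i)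
≤ˡ-++⁻ (i ∷ a) (≡≤ le) = ≤ˡ-++⁻ a le

mutual
  sub-++ : ∀ t a x {u} → sub t a ≡ just u → sub t (a ++ x) ≡ sub u x
  sub-++ t [] x refl = refl
  sub-++ (node ts) (i ∷ a) x eq = subF-++ ts i a x eq

  subF-++ : ∀ ts i a x {u} → subF ts i a ≡ just u → subF ts i (a ++ x) ≡ sub u x
  subF-++ (t ∷ ts) zero a x eq = sub-++ t a x eq
  subF-++ (t ∷ ts) (suc i) a x eq = subF-++ ts i a x eq

mutual
  sub-++⁻ : ∀ t x y {u} → sub t (x ++ y) ≡ just u → x ∈ᵀ t
  sub-++⁻ t [] y m = t , refl
  sub-++⁻ (node ts) (i ∷ x) y m = subF-++⁻ ts i x y m

  subF-++⁻ : ∀ ts i x y {u} → subF ts i (x ++ y) ≡ just u → Σ Tree λ u′ → subF ts i x ≡ just u′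
  subF-++⁻ (t ∷ ts) zero x y m = sub-++⁻ t x y m
  subF-++⁻ (t ∷ ts) (suc i) x y m = subF-++⁻ ts i x y m

subF-< : ∀ ts i a {u} → subF ts i a ≡ just u → i < length ts
subF-< (t ∷ ts) zero a eq = s≤s z≤n
subF-< (t ∷ ts) (suc i) a eq = s≤s (subF-< ts i a eq)

subF-child : ∀ ts i → i < length ts → Σ Tree λ u → subF ts i [] ≡ just u
subF-child (t ∷ ts) zero _ = t , refl
subF-child (t ∷ ts) (suc i) (s≤s i<n) = subF-child ts i i<n

subF-replicate : ∀ n t i a → i < n → subF (replicate n t) i a ≡ sub t a
subF-replicate (suc n) t zero a _ = refl
subF-replicate (suc n) t (suc i) a (s≤s i<n) = subF-replicate n t i a i<n

sub-leaf : ∀ a {u} → sub (node []) a ≡ just u → a ≡ []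
sub-leaf [] _ = refl
sub-leaf (i ∷ a) ()

mutual
  nodes-∈ᵀ : ∀ t → All (_∈ᵀ t) (nodes t)
  nodes-∈ᵀ (node ts) = (node ts , refl) ∷ nodesF-∈ᵀ ts 0 ts (λ k x m → m)

  -- ts is the suffix of ps starting at position i
  nodesF-∈ᵀ : ∀ ps i ts → (∀ k x {u} → subF ts k x ≡ just u → subF ps (i + k) x ≡ just u) →
    All (_∈ᵀ node ps) (nodesF i ts)
  nodesF-∈ᵀ ps i [] h = []
  nodesF-∈ᵀ ps i (t ∷ ts) h = ++⁺
    (gmap⁺ (λ {x} (u , m) → u , subst (λ k → subF ps k x ≡ just u) (+-identityʳ i) (h 0 x m)) (nodes-∈ᵀ t))
    (nodesF-∈ᵀ ps (suc i) ts (λ k x {u} m → subst (λ j → subF ps j x ≡ just u) (+-suc i k) (h (suc k) x m)))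

table-cong : ∀ S {f g : Addr → Addr} → (∀ a → a ∈ᵀ S → f a ≡ g a) → table S f ≡ table S g
table-cong S f≈g = map-cong-local (All.map (f≈g _) (nodes-∈ᵀ S))

∀⊎∃ : ∀ n {A B : Fin n → Set} → (∀ i → A i ⊎ B i) → (∀ i → A i) ⊎ Σ (Fin n) B
∀⊎∃ zero _ = inj₁ λ ()
∀⊎∃ (suc n) {A} {B} A⊎B with A⊎B zero | ∀⊎∃ n {A ∘ suc} {B ∘ suc} (A⊎B ∘ suc)
... | inj₂ b₀ | _ = inj₂ (zero , b₀)
... | inj₁ _ | inj₂ (i , bᵢ) = inj₂ (suc i , bᵢ)
... | inj₁ a₀ | inj₁ aₛ = inj₁ λ { zero → a₀ ; (suc i) → aₛ i }

∷ʳ≢[] : ∀ (v : Addr) i → v ∷ʳ i ≢ []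
∷ʳ≢[] [] i ()
∷ʳ≢[] (x ∷ v) i ()

∷ʳ-∈ᵀ : ∀ t a {cs} → sub t a ≡ just (node cs) → ∀ i → i < length cs → (a ∷ʳ i) ∈ᵀ t
∷ʳ-∈ᵀ t a {cs} a↦ i i<n with subF-child cs i i<n
... | u , i↦ = u , trans (sub-++ t a (i ∷ []) a↦) i↦

∷ʳ-∈ᵀ⁻ : ∀ t a {cs} → sub t a ≡ just (node cs) → ∀ i → (a ∷ʳ i) ∈ᵀ t → i < length cs
∷ʳ-∈ᵀ⁻ t a {cs} a↦ i (_ , ai↦) = subF-< cs i [] (trans (sym (sub-++ t a (i ∷ []) a↦)) ai↦)

≼-leaf : ∀ t q y → sub t q ≡ just (node []) → q ≼ y → y ∈ᵀ t → y ≡ q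
≼-leaf t q y q↦ (z , q++z≡y) (u , y↦)
  with sub-leaf z (trans (sym (sub-++ t q z q↦)) (subst (λ w → sub t w ≡ just u) (sym q++z≡y) y↦))
... | refl = trans (sym q++z≡y) (++-identityʳ q)

++-∷-residual : ∀ (q : Addr) {k w y z r} → q ++ (k ∷ w) ≡ y → y ++ z ≡ q ++ r → r ≡ k ∷ (w ++ z)
++-∷-residual q {k} {w} {y} {z} {r} q++kw≡y y++z≡q++r =
  sym (++-cancelˡ q (k ∷ (w ++ z)) r (trans (sym (++-assoc q (k ∷ w) z)) (trans (cong (_++ z) q++kw≡y) y++z≡q++r)))

module _ {S T f} (E : IsEmbedding S T f) where

  open IsEmbedding E

  embedding-≼ : ∀ a x → a ∈ᵀ S → (a ++ x) ∈ᵀ S → f a ≼ f (a ++ x)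
  embedding-≼ a x a∈S ax∈S =
    a∧b≡a⇒a≼b (f a) (f (a ++ x)) (trans (sym (morphism a (a ++ x) a∈S ax∈S)) (cong f (a∧a++x≡a a x)))

module ChildAlignment {S T f} (E : IsEmbedding S T f) {a cs} (a↦ : sub S a ≡ just (node cs)) where

  open IsEmbedding E

  private
    a∈S : a ∈ᵀ S
    a∈S = _ , a↦

    child∈S : ∀ i → i < length cs → (a ∷ʳ i) ∈ᵀ S
    child∈S = ∷ʳ-∈ᵀ S a a↦

    child-< : ∀ i → (a ∷ʳ i) ∈ᵀ S → i < length cs
    child-< = ∷ʳ-∈ᵀ⁻ S a a↦

    Below : ℕ → ℕ → Set
    Below i k = Σ Addr λ w → f (a ∷ʳ i) ≡ f a ++ (k ∷ w)

    below⇒≼ : ∀ {i k} → Below i k → (f a ∷ʳ k) ≼ f (a ∷ʳ i)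
    below⇒≼ {k = k} (w , p) = w , trans (sym (++-∷ (f a) k w)) (sym p)

    ≼⇒below : ∀ {i k} → (f a ∷ʳ k) ≼ f (a ∷ʳ i) → Below i k
    ≼⇒below {k = k} (w , q) = w , trans (sym q) (sym (++-∷ (f a) k w))

    below-∈ᵀ : ∀ {i k} → i < length cs → Below i k → (f a ∷ʳ k) ∈ᵀ T
    below-∈ᵀ {i} {k} i<n (w , p) with maps-to (a ∷ʳ i) (child∈S i i<n)
    ... | u , fai↦ = sub-++⁻ T (f a ∷ʳ k) w (subst (λ y → sub T y ≡ just u) (trans p (++-∷ (f a) k w)) fai↦)

    below-some : ∀ i → i < length cs → Σ ℕ (Below i)
    below-some i i<n = ≼∧≢⇒child (f a) (f (a ∷ʳ i)) (embedding-≼ E a (i ∷ []) a∈S (child∈S i i<n))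
      λ eq → a++k∷w≢a a i [] (injective (a ∷ʳ i) a (child∈S i i<n) a∈S eq)

    below-unique : ∀ {i k k′} → Below i k → Below i k′ → k ≡ k′
    below-unique (w , p) (w′ , p′) = proj₁ (∷-injective (++-cancelˡ (f a) _ _ (trans (sym p) p′)))

    below-< : ∀ {i i′ k k′} → i < i′ → i′ < length cs → Below i k → Below i′ k′ → k < k′
    below-< {i} {i′} {k} i<i′ i′<n (w , p) (w′ , p′)
      with ≤ˡ-++⁻ (f a) (subst₂ _≤ˡ_ p p′ (order-preserving (a ∷ʳ i) (a ∷ʳ i′)
             (child∈S i (<-trans i<i′ i′<n)) (child∈S i′ i′<n) (≤ˡ-++⁺ a (<≤ i<i′))))
    ... | <≤ k<k′ = k<k′
    ... | ≡≤ _ = ⊥-elim (a++k∷w≢a (f a) k (w ∧ w′) (sym fa≡))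
      where
      open ≡-Reasoning
      fa≡ : f a ≡ f a ++ (k ∷ (w ∧ w′))
      fa≡ = begin
        f a                                 ≡⟨ cong f (sym (∧-siblings a (<⇒≢ i<i′))) ⟩
        f ((a ∷ʳ i) ∧ (a ∷ʳ i′))            ≡⟨ morphism (a ∷ʳ i) (a ∷ʳ i′) (child∈S i (<-trans i<i′ i′<n)) (child∈S i′ i′<n) ⟩
        f (a ∷ʳ i) ∧ f (a ∷ʳ i′)            ≡⟨ cong₂ _∧_ p p′ ⟩
        (f a ++ (k ∷ w)) ∧ (f a ++ (k ∷ w′)) ≡⟨ ∧-++ (f a) (k ∷ w) (k ∷ w′) ⟩
        f a ++ ((k ∷ w) ∧ (k ∷ w′))         ≡⟨ cong (f a ++_) (∧-∷-≡ k w w′) ⟩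
        f a ++ (k ∷ (w ∧ w′))               ∎

    below-≥ : ∀ i → i < length cs → ∀ {k} → Below i k → i ≤ k
    below-≥ zero _ _ = z≤n
    below-≥ (suc i) i<n below with below-some i (<-trans (n<1+n i) i<n)
    ... | k₀ , below₀ = ≤-trans (s≤s (below-≥ i (<-trans (n<1+n i) i<n) below₀)) (below-< (n<1+n i) i<n below₀ below)

    -- Child i goes below some child k ≥ i of f a.  By the initial segment condition the
    -- child i of f a lies below the image of some child i′, and both i′ < i (induction)
    -- and i′ > i (then i ≤ k < i) are impossible.
    below-self : ∀ n i → i < n → i < length cs → Below i i
    below-self (suc n) i (s≤s i≤n) i<len with below-some i i<len
    ... | k , below with initial-segment a a∈S i k (below-≥ i i<len below) (below-∈ᵀ i<len below)
                           (i , child∈S i i<len , below⇒≼ below)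
    ... | i′ , i′∈S , fai≼fai′ with <-cmp i′ i
    ...   | tri≈ _ refl _ = ≼⇒below fai≼fai′
    ...   | tri< i′<i _ _ = ⊥-elim (<-irrefl
            (below-unique (below-self n i′ (≤-trans i′<i i≤n) (child-< i′ i′∈S)) (≼⇒below fai≼fai′)) i′<i)
    ...   | tri> _ _ i<i′ = ⊥-elim (<-irrefl refl
            (≤-<-trans (below-≥ i i<len below) (below-< i<i′ (child-< i′ i′∈S) below (≼⇒below fai≼fai′))))

  -- opaque: only the types of these are ever needed, and unfolding them is expensive
  opaque
    child-aligned : ∀ i → i < length cs → (f a ∷ʳ i) ≼ f (a ∷ʳ i)
    child-aligned i i<n = below⇒≼ (below-self (suc i) i ≤-refl i<n)

    child-image : ∀ i → i < length cs → (f a ∷ʳ i) ∈ᵀ T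
    child-image i i<n = below-∈ᵀ i<n (below-self (suc i) i ≤-refl i<n)

id-isLPEmbedding : ∀ T → IsLPEmbedding T T id
id-isLPEmbedding T = record
  { embedding = record
    { maps-to = λ _ a∈T → a∈T
    ; injective = λ _ _ _ _ eq → eq
    ; morphism = λ _ _ _ _ → refl
    ; order-preserving = λ _ _ _ _ a≤b → a≤b
    ; initial-segment = initial-segment
    }
  ; leaf-preserving = λ _ leaf → leaf
  }
  where
  initial-segment : ∀ v → v ∈ᵀ T → ∀ j k → j ≤ k → (v ∷ʳ k) ∈ᵀ T →
    (Σ ℕ λ i → (v ∷ʳ i) ∈ᵀ T × (v ∷ʳ k) ≼ (v ∷ʳ i)) →
    Σ ℕ λ i → (v ∷ʳ i) ∈ᵀ T × (v ∷ʳ j) ≼ (v ∷ʳ i)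
  initial-segment v (node cs , v↦) j k j≤k vk∈T _ =
    j , ∷ʳ-∈ᵀ T v v↦ j (≤-<-trans j≤k (∷ʳ-∈ᵀ⁻ T v v↦ k vk∈T)) , [] , ++-identityʳ (v ∷ʳ j)

into-leaf : ∀ S f → IsEmbedding S (node []) f → table S f ≡ table S (λ _ → [])
into-leaf S f E = table-cong S λ a a∈S → sub-leaf (f a) (proj₂ (IsEmbedding.maps-to E a a∈S))

-- Emb S K codes the leaf preserving embeddings of S into the complete b-ary tree of
-- height K (see Semantics): such an embedding either sends the root to the root, and
-- then (initial segment condition) the i-th child into the i-th subtree, or it sends
-- all of S into one of the b subtrees.  Hom M K codes the embeddings of the complete
-- tree of height M; it is kept apart from Emb so that codes compose structurally.
module Codes (b-1 : ℕ) where

  b : ℕ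
  b = suc b-1

  mutual
    data Emb : Tree → ℕ → Set where
      leaf  : Emb (node []) zero
      here  : ∀ {c cs K} → Embs (c ∷ cs) K → length (c ∷ cs) ≤ b → Emb (node (c ∷ cs)) (suc K)
      there : ∀ {S K} → Fin b → Emb S K → Emb S (suc K)

    data Embs : List Tree → ℕ → Set where
      [] : ∀ {K} → Embs [] K
      _∷_ : ∀ {s L K} → Emb s K → Embs L K → Embs (s ∷ L) K

  mutual
    data Hom : ℕ → ℕ → Set where
      leaf  : Hom zero zero
      here  : ∀ {M K} → Homs b M K → Hom (suc M) (suc K)
      there : ∀ {M K} → Fin b → Hom M K → Hom M (suc K)

    data Homs : ℕ → ℕ → ℕ → Set where
      [] : ∀ {M K} → Homs zero M K
      _∷_ : ∀ {n M K} → Hom M K → Homs n M K → Homs (suc n) M K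

  infixl 6 _·_ _⨾_

  mutual
    _·_ : ∀ {S M K} → Emb S M → Hom M K → Emb S K
    e · there i g = there i (e · g)
    leaf · leaf = leaf
    here es p · here H = here (actPrefix es p H) p
    there i e · here H = there i (actAt e H i)

    actAt : ∀ {S M K n} → Emb S M → Homs n M K → Fin n → Emb S K
    actAt e (g ∷ H) zero = e · g
    actAt e (g ∷ H) (suc i) = actAt e H i

    actPrefix : ∀ {L M K n} → Embs L M → length L ≤ n → Homs n M K → Embs L K
    actPrefix [] _ H = []
    actPrefix (e ∷ es) (s≤s p) (g ∷ H) = e · g ∷ actPrefix es p H

  actAll : ∀ {L M K} → Embs L M → Homs (length L) M K → Embs L K
  actAll es H = actPrefix es ≤-refl H

  mutual
    _⨾_ : ∀ {M K L} → Hom M K → Hom K L → Hom M L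
    g ⨾ there i h = there i (g ⨾ h)
    leaf ⨾ leaf = leaf
    here G ⨾ here H = here (compAll G H)
    there i g ⨾ here H = there i (compAt g H i)

    compAt : ∀ {M K L n} → Hom M K → Homs n K L → Fin n → Hom M L
    compAt g (h ∷ H) zero = g ⨾ h
    compAt g (h ∷ H) (suc i) = compAt g H i

    compAll : ∀ {n M K L} → Homs n M K → Homs n K L → Homs n M L
    compAll [] [] = []
    compAll (g ∷ G) (h ∷ H) = g ⨾ h ∷ compAll G H

  mutual
    ·-⨾ : ∀ {S M K L} (e : Emb S M) (g : Hom M K) (h : Hom K L) → e · g · h ≡ e · (g ⨾ h)
    ·-⨾ e g (there i h) = cong (there i) (·-⨾ e g h)
    ·-⨾ leaf leaf leaf = refl
    ·-⨾ e (there i g) (here H) = cong (there i) (actAt-compAt e g H i)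
    ·-⨾ (here es p) (here G) (here H) = cong (λ es′ → here es′ p) (actPrefix-compAll es p G H)
    ·-⨾ (there i e) (here G) (here H) = cong (there i) (actAt-compAll e G H i)

    actAt-compAt : ∀ {S M K L n} (e : Emb S M) (g : Hom M K) (H : Homs n K L) (i : Fin n) →
      actAt (e · g) H i ≡ e · compAt g H i
    actAt-compAt e g (h ∷ H) zero = ·-⨾ e g h
    actAt-compAt e g (h ∷ H) (suc i) = actAt-compAt e g H i

    actAt-compAll : ∀ {S M K L n} (e : Emb S M) (G : Homs n M K) (H : Homs n K L) (i : Fin n) →
      actAt (actAt e G i) H i ≡ actAt e (compAll G H) i
    actAt-compAll e (g ∷ G) (h ∷ H) zero = ·-⨾ e g h
    actAt-compAll e (g ∷ G) (h ∷ H) (suc i) = actAt-compAll e G H i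

    actPrefix-compAll : ∀ {L M K K′ n} (es : Embs L M) (p : length L ≤ n) (G : Homs n M K) (H : Homs n K K′) →
      actPrefix (actPrefix es p G) p H ≡ actPrefix es p (compAll G H)
    actPrefix-compAll [] p G H = refl
    actPrefix-compAll (e ∷ es) (s≤s p) (g ∷ G) (h ∷ H) = cong₂ _∷_ (·-⨾ e g h) (actPrefix-compAll es p G H)

  actAll-compAll : ∀ {L M K K′} (es : Embs L M) (G : Homs (length L) M K) (H : Homs (length L) K K′) →
    actAll (actAll es G) H ≡ actAll es (compAll G H)
  actAll-compAll es = actPrefix-compAll es ≤-refl

  replicateʰ : ∀ n {M K} → Hom M K → Homs n M K
  replicateʰ zero g = []
  replicateʰ (suc n) g = g ∷ replicateʰ n g

  tabulateʰ : ∀ {n M K} → (Fin n → Hom M K) → Homs n M K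
  tabulateʰ {zero} g = []
  tabulateʰ {suc n} g = g zero ∷ tabulateʰ (g ∘ suc)

  actAt-replicate : ∀ {S M K n} (e : Emb S M) (g : Hom M K) (i : Fin n) → actAt e (replicateʰ n g) i ≡ e · g
  actAt-replicate e g zero = refl
  actAt-replicate e g (suc i) = actAt-replicate e g i

  actAt-tabulate : ∀ {S M K n} (e : Emb S M) (g : Fin n → Hom M K) (i : Fin n) → actAt e (tabulateʰ g) i ≡ e · g i
  actAt-tabulate e g zero = refl
  actAt-tabulate e g (suc i) = actAt-tabulate e (g ∘ suc) i

  -- needs b > 0: surplus height is spent by descending into the first subtree
  lift : ∀ {M K} → M ≤ K → Hom M K
  lift {zero} {zero} z≤n = leaf
  lift {zero} {suc K} z≤n = there zero (lift z≤n)
  lift (s≤s M≤K) = here (replicateʰ b (lift M≤K))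

  Emb-branching : ∀ {c cs K} → Emb (node (c ∷ cs)) K → length (c ∷ cs) ≤ b
  Emb-branching (here _ p) = p
  Emb-branching (there _ e) = Emb-branching e

  Position : Set
  Position = List (Fin b)

  rootPosition : ∀ {S K} → Emb S K → Position
  rootPosition leaf = []
  rootPosition (here _ _) = []
  rootPosition (there i e) = i ∷ rootPosition e

  mutual
    moveBy : ∀ {M K} → Hom M K → Position → Position
    moveBy leaf x = x
    moveBy (there i g) x = i ∷ moveBy g x
    moveBy (here H) [] = []
    moveBy (here H) (i ∷ x) = i ∷ moveByAt H i x

    moveByAt : ∀ {n M K} → Homs n M K → Fin n → Position → Position
    moveByAt (g ∷ H) zero x = moveBy g x
    moveByAt (g ∷ H) (suc i) x = moveByAt H i x

  mutual
    rootPosition-· : ∀ {S M K} (e : Emb S M) (g : Hom M K) → rootPosition (e · g) ≡ moveBy g (rootPosition e)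
    rootPosition-· e (there i g) = cong (i ∷_) (rootPosition-· e g)
    rootPosition-· leaf leaf = refl
    rootPosition-· (here es p) (here H) = refl
    rootPosition-· (there i e) (here H) = cong (i ∷_) (rootPosition-actAt e H i)

    rootPosition-actAt : ∀ {S M K n} (e : Emb S M) (H : Homs n M K) (i : Fin n) →
      rootPosition (actAt e H i) ≡ moveByAt H i (rootPosition e)
    rootPosition-actAt e (g ∷ H) zero = rootPosition-· e g
    rootPosition-actAt e (g ∷ H) (suc i) = rootPosition-actAt e H i

module Ramsey (b-1 : ℕ) where

  open Codes b-1

  RootsColoured : Tree → (Position → Bool) → Bool → ℕ → ℕ → Set
  RootsColoured S Q v M N = Σ (Hom M N) λ g → ∀ (e : Emb S M) → Q (rootPosition (e · g)) ≡ v

  leaf-search : ∀ N Q v → RootsColoured (node []) Q v zero N ⊎ (∀ (e : Emb (node []) N) → Q (rootPosition e) ≡ not v)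
  leaf-search zero Q v with Q [] ≟ᵇ v
  ... | yes q = inj₁ (leaf , λ { leaf → q })
  ... | no q = inj₂ λ { leaf → ¬-not q }
  leaf-search (suc N) Q v with ∀⊎∃ b (λ i → swap (leaf-search N (Q ∘ (i ∷_)) v))
  ... | inj₁ all = inj₂ λ { (there i e) → all i e }
  ... | inj₂ (i , g , q) = inj₁ (there i g , q)

  -- An embedding into height suc N maps the root either to the root, where Q is v,
  -- or into a subtree i, where the hypothesis for Q shifted by i applies.
  root-split-step : ∀ {S Q v w a c N} → Q [] ≡ v →
    (∀ i → RootsColoured S (Q ∘ (i ∷_)) v a N ⊎ RootsColoured S (Q ∘ (i ∷_)) w c N) →
    RootsColoured S Q v (suc a) (suc N) ⊎ RootsColoured S Q w c (suc N)
  root-split-step {S} {Q} {v} {a = a} q[] split with ∀⊎∃ b split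
  ... | inj₂ (i , g , q) = inj₂ (there i g , q)
  ... | inj₁ all = inj₁ (here (tabulateʰ (proj₁ ∘ all)) , root-or-subtree)
    where
    root-or-subtree : ∀ (e : Emb S (suc a)) → Q (rootPosition (e · here (tabulateʰ (proj₁ ∘ all)))) ≡ v
    root-or-subtree (here _ _) = q[]
    root-or-subtree (there i e) =
      trans (cong (λ e′ → Q (i ∷ rootPosition e′)) (actAt-tabulate e (proj₁ ∘ all) i)) (proj₂ (all i) e)

  root-split : ∀ S N a c → a + c ≡ N → ∀ Q → RootsColoured S Q true a N ⊎ RootsColoured S Q false c N
  root-split (node []) N zero c a+c≡N Q with leaf-search N Q true
  ... | inj₁ coloured = inj₁ coloured
  ... | inj₂ all = inj₂ (lift (≤-reflexive a+c≡N) , λ e → all _)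
  root-split (node (_ ∷ _)) N zero c _ Q = inj₁ (lift z≤n , λ ())
  root-split (node []) N (suc a) zero a+0≡N Q with leaf-search N Q false
  ... | inj₁ coloured = inj₂ coloured
  ... | inj₂ all = inj₁ (lift (≤-reflexive (trans (sym (+-identityʳ _)) a+0≡N)) , λ e → all _)
  root-split (node (_ ∷ _)) N (suc a) zero _ Q = inj₂ (lift z≤n , λ ())
  root-split S (suc N) (suc a) (suc c) a+c≡N Q with Q [] in q[]
  ... | true = root-split-step {Q = Q} q[] λ i → root-split S N a (suc c) (suc-injective a+c≡N) (Q ∘ (i ∷_))
  ... | false = swap (root-split-step {Q = Q} q[] λ i →
    swap (root-split S N (suc a) c (trans (sym (+-suc a c)) (suc-injective a+c≡N)) (Q ∘ (i ∷_))))

  isZero : ∀ {n} → Fin (suc n) → Bool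
  isZero zero = true
  isZero (suc _) = false

  predFin : ∀ {n} → Fin (suc (suc n)) → Fin (suc n)
  predFin zero = zero
  predFin (suc k) = k

  isZero⇒≡zero : ∀ {n} {x : Fin (suc n)} → isZero x ≡ true → x ≡ zero
  isZero⇒≡zero {x = zero} _ = refl

  ¬isZero⇒≡suc : ∀ {n} {x : Fin (suc (suc n))} → isZero x ≡ false → x ≡ suc (predFin x)
  ¬isZero⇒≡suc {x = suc _} _ = refl

  Fin1-≡zero : (x : Fin 1) → x ≡ zero
  Fin1-≡zero zero = refl

  -- The colour classes are split off one at a time by root-split.
  root-ramsey : ∀ S M d → Σ ℕ λ N → ∀ (γ : Position → Fin (suc d)) →
    Σ (Hom M N) λ g → Σ (Fin (suc d)) λ κ → ∀ (e : Emb S M) → γ (rootPosition (e · g)) ≡ κ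
  root-ramsey S M zero = M , λ γ → lift ≤-refl , zero , λ e → Fin1-≡zero _
  root-ramsey S M (suc d) = M + N′ , colour
    where
    N′ : ℕ
    N′ = proj₁ (root-ramsey S M d)
    colour : ∀ (γ : Position → Fin (suc (suc d))) →
      Σ (Hom M (M + N′)) λ g → Σ (Fin (suc (suc d))) λ κ → ∀ (e : Emb S M) → γ (rootPosition (e · g)) ≡ κ
    colour γ with root-split S (M + N′) M N′ refl (isZero ∘ γ)
    ... | inj₁ (g , zeroColoured) = g , zero , λ e → isZero⇒≡zero (zeroColoured e)
    ... | inj₂ (g , nonzero) with proj₂ (root-ramsey S M d) (predFin ∘ γ ∘ moveBy g)
    ... | g′ , κ , mono = g′ ⨾ g , suc κ , λ e → begin
      γ (rootPosition (e · (g′ ⨾ g)))                  ≡⟨ cong (γ ∘ rootPosition) (sym (·-⨾ e g′ g)) ⟩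
      γ (rootPosition (e · g′ · g))                    ≡⟨ ¬isZero⇒≡suc (nonzero (e · g′)) ⟩
      suc (predFin (γ (rootPosition (e · g′ · g))))    ≡⟨ cong (suc ∘ predFin ∘ γ) (rootPosition-· (e · g′) g) ⟩
      suc (predFin (γ (moveBy g (rootPosition (e · g′))))) ≡⟨ cong suc (mono e) ⟩
      suc κ                                             ∎
      where open ≡-Reasoning

  -- stated for all K ≥ K₀, so that bounds obtained for several trees combine by ⊔
  ProductRamsey : List Tree → ℕ → ℕ → Set
  ProductRamsey L M d = Σ ℕ λ K₀ → ∀ K → K₀ ≤ K → ∀ (χ : Embs L K → Fin (suc d)) →
    Σ (Homs (length L) M K) λ H → Σ (Fin (suc d)) λ κ → ∀ (es : Embs L M) → χ (actAll es H) ≡ κ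

  ReducedToRoot : ∀ {S R K d} → (Emb S K → Embs R K → Fin (suc d)) → ℕ → ℕ → Set
  ReducedToRoot {S} {R} {K} {d} χ N M = Σ (Hom N K) λ g → Σ (Homs (length R) M K) λ gs →
    Σ (Position → Fin (suc d)) λ γ → ∀ (e : Emb S N) es → χ (e · g) (actAll es gs) ≡ γ (rootPosition e)

  RootReduction : Tree → List Tree → ℕ → ℕ → ℕ → Set
  RootReduction S R N M d = Σ ℕ λ K₀ → ∀ K → K₀ ≤ K → ∀ (χ : Emb S K → Embs R K → Fin (suc d)) → ReducedToRoot χ N M

  RootReductions : ℕ → Tree → List Tree → ℕ → ℕ → ℕ → Set
  RootReductions n S R N M d = Σ ℕ λ K₀ → ∀ K → K₀ ≤ K → ∀ (χ : Fin n → Emb S K → Embs R K → Fin (suc d)) →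
    Σ (Homs n N K) λ G → Σ (Homs (length R) M K) λ gs → Σ (Fin n → Position → Fin (suc d)) λ γ →
      ∀ j e es → χ j (actAt e G j) (actAll es gs) ≡ γ j (rootPosition e)

  root-reductions : ∀ {S R N d} → (∀ M → RootReduction S R N M d) → ∀ n M → RootReductions n S R N M d
  root-reductions red zero M = M , λ K M≤K χ → [] , replicateʰ _ (lift M≤K) , (λ ()) , λ ()
  root-reductions {S} {R} {N} {d} red (suc n) M = proj₁ (red K′) ⊔ K′ , reduce
    where
    K′ : ℕ
    K′ = proj₁ (root-reductions red n M)
    down : ∀ {K} → proj₁ (red K′) ⊔ K′ ≤ K → Hom K′ K
    down bound = lift (≤-trans (m≤n⊔m _ _) bound)
    reduce : ∀ K → proj₁ (red K′) ⊔ K′ ≤ K → ∀ (χ : Fin (suc n) → Emb S K → Embs R K → Fin (suc d)) →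
      Σ (Homs (suc n) N K) λ G → Σ (Homs (length R) M K) λ gs → Σ (Fin (suc n) → Position → Fin (suc d)) λ γ →
        ∀ j e es → χ j (actAt e G j) (actAll es gs) ≡ γ j (rootPosition e)
    reduce K bound χ with proj₂ (red K′) K (≤-trans (m≤m⊔n _ _) bound) (χ zero)
    ... | g₀ , gs₀ , γ₀ , by-root₀ with proj₂ (root-reductions red n M) K′ ≤-refl
                                     (λ j e es → χ (suc j) (e · down bound) (actAll es gs₀))
    ... | G , gs , γₛ , by-rootₛ =
      g₀ ∷ compAll G (replicateʰ n (down bound)) , compAll gs gs₀ , γ , by-root
      where
      γ : Fin (suc n) → Position → Fin (suc d)
      γ zero = γ₀
      γ (suc j) = γₛ j
      by-root : ∀ j e es → χ j (actAt e (g₀ ∷ compAll G (replicateʰ n (down bound))) j) (actAll es (compAll gs gs₀)) ≡ γ j (rootPosition e)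
      by-root zero e es = trans (cong (χ zero (e · g₀)) (sym (actAll-compAll es gs gs₀))) (by-root₀ e (actAll es gs))
      by-root (suc j) e es = trans
        (cong₂ (χ (suc j)) (trans (sym (actAt-compAll e G _ j)) (actAt-replicate _ (down bound) j))
                           (sym (actAll-compAll es gs gs₀)))
        (by-rootₛ j e es)

  root-and-subtrees : ∀ {S R N M K d} (EF : RootReductions b S R N M d)
    (H₀ : Homs b (proj₁ EF) K) (R₀ : Homs (length R) (proj₁ EF) (suc K))
    (χ : Emb S (suc K) → Embs R (suc K) → Fin (suc d)) (κ : Fin (suc d)) →
    (∀ e → rootPosition e ≡ [] → ∀ es → χ (e · here H₀) (actAll es R₀) ≡ κ) →
    ReducedToRoot χ (suc N) M
  root-and-subtrees {S} {R} {N} {M} {K} {d} EF H₀ R₀ χ κ atRoot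
    with proj₂ EF (proj₁ EF) ≤-refl (λ j e es → χ (there j (actAt e H₀ j)) (actAll es R₀))
  ... | G , gs , γₛ , by-rootₛ = here (compAll G H₀) , compAll gs R₀ , γ , by-root
    where
    γ : Position → Fin (suc d)
    γ [] = κ
    γ (j ∷ x) = γₛ j x
    by-root : ∀ (e : Emb S (suc N)) es → χ (e · here (compAll G H₀)) (actAll es (compAll gs R₀)) ≡ γ (rootPosition e)
    by-root (here t p) es = trans
      (cong₂ χ (cong (λ t′ → here t′ p) (sym (actPrefix-compAll t p G H₀))) (sym (actAll-compAll es gs R₀)))
      (atRoot (here (actPrefix t p G) p) refl (actAll es gs))
    by-root (there j e) es = trans
      (cong₂ χ (cong (there j) (sym (actAt-compAll e G H₀ j))) (sym (actAll-compAll es gs R₀)))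
      (by-rootₛ j e es)

  _++ᴱ_ : ∀ {A B K} → Embs A K → Embs B K → Embs (A ++ B) K
  [] ++ᴱ fs = fs
  (e ∷ es) ++ᴱ fs = e ∷ (es ++ᴱ fs)

  takeᴱ : ∀ A {B K} → Embs (A ++ B) K → Embs A K
  takeᴱ [] _ = []
  takeᴱ (_ ∷ A) (e ∷ es) = e ∷ takeᴱ A es

  dropᴱ : ∀ A {B K} → Embs (A ++ B) K → Embs B K
  dropᴱ [] es = es
  dropᴱ (_ ∷ A) (_ ∷ es) = dropᴱ A es

  takeʰ : ∀ (A : List Tree) {B : List Tree} {M K} → Homs (length (A ++ B)) M K → Homs (length A) M K
  takeʰ [] _ = []
  takeʰ (_ ∷ A) (h ∷ H) = h ∷ takeʰ A H

  dropʰ : ∀ (A : List Tree) {B : List Tree} {M K} → Homs (length (A ++ B)) M K → Homs (length B) M K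
  dropʰ [] H = H
  dropʰ (_ ∷ A) (_ ∷ H) = dropʰ A H

  takeᴱ-actAll : ∀ {A B M K} (es : Embs A M) (fs : Embs B M) (H : Homs (length (A ++ B)) M K) →
    takeᴱ A (actAll (es ++ᴱ fs) H) ≡ actAll es (takeʰ A H)
  takeᴱ-actAll [] fs H = refl
  takeᴱ-actAll (e ∷ es) fs (h ∷ H) = cong (e · h ∷_) (takeᴱ-actAll es fs H)

  dropᴱ-actAll : ∀ {A B M K} (es : Embs A M) (fs : Embs B M) (H : Homs (length (A ++ B)) M K) →
    dropᴱ A (actAll (es ++ᴱ fs) H) ≡ actAll fs (dropʰ A H)
  dropᴱ-actAll [] fs H = refl
  dropᴱ-actAll (e ∷ es) fs (h ∷ H) = dropᴱ-actAll es fs H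

  padʰ : ∀ n {m M K} → Homs m M K → m ≤ n → Hom M K → Homs n M K
  padʰ n [] z≤n g = replicateʰ n g
  padʰ (suc n) (h ∷ H) (s≤s m≤n) g = h ∷ padʰ n H m≤n g

  actPrefix-padʰ : ∀ {L M K n} (es : Embs L M) (p : length L ≤ n) (H : Homs (length L) M K) (q : length L ≤ n) g →
    actPrefix es p (padʰ n H q g) ≡ actAll es H
  actPrefix-padʰ [] p H q g = refl
  actPrefix-padʰ (e ∷ es) (s≤s p) (h ∷ H) (s≤s q) g = cong (e · h ∷_) (actPrefix-padʰ es p H q g)

  headʰ : ∀ {m M K} → Homs (suc m) M K → Hom M K
  headʰ (h ∷ _) = h

  up : ∀ {K} → Hom K (suc K)
  up = lift (n≤1+n _)

  -- A root-to-root embedding is its tuple of restrictions to the subtrees, so the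
  -- product Ramsey property for the subtrees followed by R fixes its colour.
  root-colour-constant : ∀ {c cs R Kc K d} → length (c ∷ cs) ≤ b →
    (P : ProductRamsey ((c ∷ cs) ++ R) Kc d) → proj₁ P ≤ K →
    (χ : Emb (node (c ∷ cs)) (suc K) → Embs R (suc K) → Fin (suc d)) →
    Σ (Homs b Kc K) λ H₀ → Σ (Homs (length R) Kc (suc K)) λ R₀ → Σ (Fin (suc d)) λ κ →
      ∀ e → rootPosition e ≡ [] → ∀ es → χ (e · here H₀) (actAll es R₀) ≡ κ
  root-colour-constant {c} {cs} {R} {Kc} {K} branching (_ , ramsey′) K₀≤K χ
    with ramsey′ K K₀≤K (λ u → χ (here (takeᴱ (c ∷ cs) u) branching) (actAll (dropᴱ (c ∷ cs) u) (replicateʰ _ up)))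
  ... | H , κ , mono = padʰ b (takeʰ (c ∷ cs) H) branching (headʰ (takeʰ (c ∷ cs) H))
                     , compAll (dropʰ (c ∷ cs) H) (replicateʰ _ up) , κ , atRoot
    where
    atRoot : ∀ e → rootPosition e ≡ [] → ∀ es →
      χ (e · here (padʰ b (takeʰ (c ∷ cs) H) branching (headʰ (takeʰ (c ∷ cs) H))))
        (actAll es (compAll (dropʰ (c ∷ cs) H) (replicateʰ _ up))) ≡ κ
    atRoot (here t p) refl es = trans (cong₂ χ subtrees rest) (mono (t ++ᴱ es))
      where
      subtrees : here (actPrefix t p (padʰ b (takeʰ (c ∷ cs) H) branching (headʰ (takeʰ (c ∷ cs) H)))) p
               ≡ here (takeᴱ (c ∷ cs) (actAll (t ++ᴱ es) H)) branching
      subtrees = cong₂ here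
        (trans (actPrefix-padʰ t p _ branching _) (sym (takeᴱ-actAll t es H)))
        (≤-irrelevant p branching)
      rest : actAll es (compAll (dropʰ (c ∷ cs) H) (replicateʰ _ up))
           ≡ actAll (dropᴱ (c ∷ cs) (actAll (t ++ᴱ es) H)) (replicateʰ _ up)
      rest = trans (sym (actAll-compAll es _ _)) (cong (λ fs → actAll fs (replicateʰ _ up)) (sym (dropᴱ-actAll t es H)))

  root-reduction : ∀ cs R d → (∀ M → ProductRamsey (cs ++ R) M d) → ∀ N M → RootReduction (node cs) R N M d
  root-reduction [] R d pr zero M = proj₁ (pr M) , reduce
    where
    reduce : ∀ K → proj₁ (pr M) ≤ K → ∀ (χ : Emb (node []) K → Embs R K → Fin (suc d)) → ReducedToRoot χ zero M
    reduce K K₀≤K χ with proj₂ (pr M) K K₀≤K (χ (leaf · lift z≤n))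
    ... | H , κ , mono = lift z≤n , H , (λ _ → κ) , λ { leaf es → mono es }
  root-reduction (_ ∷ _) R d pr zero M =
    M , λ K M≤K χ → lift z≤n , replicateʰ _ (lift M≤K) , (λ _ → zero) , λ ()
  root-reduction [] R d pr (suc N) M = suc (proj₁ EF) , reduce
    where
    EF : RootReductions b (node []) R N M d
    EF = root-reductions (root-reduction [] R d pr N) b M
    reduce : ∀ K → suc (proj₁ EF) ≤ K → ∀ (χ : Emb (node []) K → Embs R K → Fin (suc d)) → ReducedToRoot χ (suc N) M
    reduce (suc K) (s≤s Kc≤K) χ = root-and-subtrees EF
      (replicateʰ b (lift Kc≤K)) (replicateʰ _ (lift (m≤n⇒m≤1+n Kc≤K))) χ zero λ { (there _ _) () }
  root-reduction (c ∷ cs) R d pr (suc N) M with length (c ∷ cs) ≤? b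
  ... | no ¬branching = suc N ⊔ M , λ K bound χ →
    lift (≤-trans (m≤m⊔n (suc N) M) bound) , replicateʰ _ (lift (≤-trans (m≤n⊔m (suc N) M) bound)) , (λ _ → zero) ,
    λ e → ⊥-elim (¬branching (Emb-branching e))
  ... | yes branching = suc (proj₁ P) , reduce
    where
    EF : RootReductions b (node (c ∷ cs)) R N M d
    EF = root-reductions (root-reduction (c ∷ cs) R d pr N) b M
    P : ProductRamsey ((c ∷ cs) ++ R) (proj₁ EF) d
    P = pr (proj₁ EF)
    reduce : ∀ K → suc (proj₁ P) ≤ K → ∀ (χ : Emb (node (c ∷ cs)) K → Embs R K → Fin (suc d)) → ReducedToRoot χ (suc N) M
    reduce (suc K) (s≤s K₀≤K) χ with root-colour-constant branching P K₀≤K χ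
    ... | H₀ , R₀ , κ , atRoot = root-and-subtrees EF H₀ R₀ χ κ atRoot

  mutual
    size : Tree → ℕ
    size (node cs) = suc (forestSize cs)

    forestSize : List Tree → ℕ
    forestSize [] = 0
    forestSize (c ∷ cs) = size c + forestSize cs

  forestSize-++ : ∀ A B → forestSize (A ++ B) ≡ forestSize A + forestSize B
  forestSize-++ [] B = refl
  forestSize-++ (a ∷ A) B = trans (cong (size a +_) (forestSize-++ A B)) (sym (+-assoc (size a) (forestSize A) (forestSize B)))

  product-ramsey : ∀ d n L → forestSize L ≤ n → ∀ M → ProductRamsey L M d
  product-ramsey d n [] _ M = 0 , λ K _ χ → [] , χ [] , λ { [] → refl }
  product-ramsey d zero (node cs ∷ R) ()
  product-ramsey d (suc n) (node cs ∷ R) (s≤s size≤n) M = proj₁ E , colour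
    where
    pr : ∀ M → ProductRamsey (cs ++ R) M d
    pr = product-ramsey d n (cs ++ R) (subst (_≤ n) (sym (forestSize-++ cs R)) size≤n)
    E : RootReduction (node cs) R (proj₁ (root-ramsey (node cs) M d)) M d
    E = root-reduction cs R d pr (proj₁ (root-ramsey (node cs) M d)) M
    colour : ∀ K → proj₁ E ≤ K → ∀ (χ : Embs (node cs ∷ R) K → Fin (suc d)) →
      Σ (Homs (suc (length R)) M K) λ H → Σ (Fin (suc d)) λ κ → ∀ es → χ (actAll es H) ≡ κ
    colour K K₀≤K χ with proj₂ E K K₀≤K (λ e es → χ (e ∷ es))
    ... | g , gs , γ , reduced with proj₂ (root-ramsey (node cs) M d) γ
    ... | g′ , κ , mono = g′ ⨾ g ∷ gs , κ , λ { (e ∷ es) →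
      trans (cong (λ e′ → χ (e′ ∷ actAll es gs)) (sym (·-⨾ e g′ g))) (trans (reduced (e · g′) es) (mono e)) }

  ramsey : ∀ S M d → Σ ℕ λ K₀ → ∀ K → K₀ ≤ K → ∀ (χ : Emb S K → Fin (suc d)) →
    Σ (Hom M K) λ g → Σ (Fin (suc d)) λ κ → ∀ e → χ (e · g) ≡ κ
  ramsey S M d with product-ramsey d (forestSize (S ∷ [])) (S ∷ []) ≤-refl M
  ... | K₀ , ramsey′ = K₀ , colour
    where
    colour : ∀ K → K₀ ≤ K → ∀ (χ : Emb S K → Fin (suc d)) →
      Σ (Hom M K) λ g → Σ (Fin (suc d)) λ κ → ∀ e → χ (e · g) ≡ κ
    colour K K₀≤K χ with ramsey′ K K₀≤K (λ { (e ∷ []) → χ e })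
    ... | g ∷ [] , κ , mono = g , κ , λ e → mono (e ∷ [])

module Semantics (b-1 : ℕ) where

  open Codes b-1

  complete : ℕ → Tree
  complete zero = node []
  complete (suc K) = node (replicate b (complete K))

  mutual
    ⟦_⟧ : ∀ {S K} → Emb S K → Addr → Addr
    ⟦ leaf ⟧ a = []
    ⟦ here es p ⟧ [] = []
    ⟦ here es p ⟧ (i ∷ a) = i ∷ ⟦ es ⟧[ i ] a
    ⟦ there i e ⟧ a = toℕ i ∷ ⟦ e ⟧ a

    ⟦_⟧[_] : ∀ {L K} → Embs L K → ℕ → Addr → Addr
    ⟦ [] ⟧[ i ] a = []
    ⟦ e ∷ es ⟧[ zero ] a = ⟦ e ⟧ a
    ⟦ e ∷ es ⟧[ suc i ] a = ⟦ es ⟧[ i ] a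

  mutual
    ⟦_⟧ʰ : ∀ {M K} → Hom M K → Addr → Addr
    ⟦ leaf ⟧ʰ a = []
    ⟦ there i g ⟧ʰ a = toℕ i ∷ ⟦ g ⟧ʰ a
    ⟦ here H ⟧ʰ [] = []
    ⟦ here H ⟧ʰ (i ∷ a) = i ∷ ⟦ H ⟧ʰ[ i ] a

    ⟦_⟧ʰ[_] : ∀ {n M K} → Homs n M K → ℕ → Addr → Addr
    ⟦ [] ⟧ʰ[ i ] a = []
    ⟦ g ∷ H ⟧ʰ[ zero ] a = ⟦ g ⟧ʰ a
    ⟦ g ∷ H ⟧ʰ[ suc i ] a = ⟦ H ⟧ʰ[ i ] a

  mutual
    ⟦·⟧ : ∀ {S M K} (e : Emb S M) (g : Hom M K) a → a ∈ᵀ S → ⟦ e · g ⟧ a ≡ ⟦ g ⟧ʰ (⟦ e ⟧ a)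
    ⟦·⟧ e (there i g) a a∈S = cong (toℕ i ∷_) (⟦·⟧ e g a a∈S)
    ⟦·⟧ leaf leaf a _ = refl
    ⟦·⟧ (here es p) (here H) [] _ = refl
    ⟦·⟧ (here es p) (here H) (i ∷ a) (_ , a∈S) = cong (i ∷_) (⟦actPrefix⟧ es p H i a a∈S)
    ⟦·⟧ (there i e) (here H) a a∈S = cong (toℕ i ∷_) (⟦actAt⟧ e H i a a∈S)

    ⟦actAt⟧ : ∀ {S M K n} (e : Emb S M) (H : Homs n M K) (i : Fin n) a → a ∈ᵀ S →
      ⟦ actAt e H i ⟧ a ≡ ⟦ H ⟧ʰ[ toℕ i ] (⟦ e ⟧ a)
    ⟦actAt⟧ e (g ∷ H) zero a a∈S = ⟦·⟧ e g a a∈S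
    ⟦actAt⟧ e (g ∷ H) (suc i) a a∈S = ⟦actAt⟧ e H i a a∈S

    ⟦actPrefix⟧ : ∀ {L M K n} (es : Embs L M) (p : length L ≤ n) (H : Homs n M K) i a {u} →
      subF L i a ≡ just u → ⟦ actPrefix es p H ⟧[ i ] a ≡ ⟦ H ⟧ʰ[ i ] (⟦ es ⟧[ i ] a)
    ⟦actPrefix⟧ (e ∷ es) (s≤s p) (g ∷ H) zero a a∈c = ⟦·⟧ e g a (_ , a∈c)
    ⟦actPrefix⟧ (e ∷ es) (s≤s p) (g ∷ H) (suc i) a a∈c = ⟦actPrefix⟧ es p H i a a∈c

  lookupᴱ : ∀ {L K} (es : Embs L K) i → i < length L →
    Σ Tree λ c → Σ (Emb c K) λ e → (∀ y → ⟦ es ⟧[ i ] y ≡ ⟦ e ⟧ y) × (∀ y → subF L i y ≡ sub c y)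
  lookupᴱ (e ∷ es) zero _ = _ , e , (λ _ → refl) , (λ _ → refl)
  lookupᴱ (e ∷ es) (suc i) (s≤s i<n) = lookupᴱ es i i<n

  sub-complete : ∀ K (i : Fin b) x → sub (complete (suc K)) (toℕ i ∷ x) ≡ sub (complete K) x
  sub-complete K i x = subF-replicate b (complete K) (toℕ i) x (toℕ<n i)

  child<b : ∀ {c cs} i x {u} → subF (c ∷ cs) i x ≡ just u → length (c ∷ cs) ≤ b → i < b
  child<b {c} {cs} i x ix∈ branching = ≤-trans (subF-< (c ∷ cs) i x ix∈) branching

  ⟦⟧-maps-to : ∀ {S K} (e : Emb S K) a → a ∈ᵀ S → ⟦ e ⟧ a ∈ᵀ complete K
  ⟦⟧-maps-to leaf a _ = node [] , refl
  ⟦⟧-maps-to {K = suc K} (there i e) a a∈S rewrite sub-complete K i (⟦ e ⟧ a) = ⟦⟧-maps-to e a a∈S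
  ⟦⟧-maps-to (here es p) [] _ = _ , refl
  ⟦⟧-maps-to {node (c ∷ cs)} {suc K} (here es p) (i ∷ a) (u , ia∈S) with lookupᴱ es i (subF-< (c ∷ cs) i a ia∈S)
  ... | c′ , e , ⟦es⟧≡⟦e⟧ , subF≡sub rewrite ⟦es⟧≡⟦e⟧ a | subF-replicate b (complete K) i (⟦ e ⟧ a) (child<b i a ia∈S p) =
    ⟦⟧-maps-to e a (u , trans (sym (subF≡sub a)) ia∈S)

  ⟦⟧-injective : ∀ {S K} (e : Emb S K) a a′ → a ∈ᵀ S → a′ ∈ᵀ S → ⟦ e ⟧ a ≡ ⟦ e ⟧ a′ → a ≡ a′
  ⟦⟧-injective leaf a a′ (_ , a∈S) (_ , a′∈S) _ rewrite sub-leaf a a∈S | sub-leaf a′ a′∈S = refl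
  ⟦⟧-injective (there i e) a a′ a∈S a′∈S eq = ⟦⟧-injective e a a′ a∈S a′∈S (proj₂ (∷-injective eq))
  ⟦⟧-injective (here es p) [] [] _ _ _ = refl
  ⟦⟧-injective (here es p) [] (j ∷ a′) _ _ ()
  ⟦⟧-injective (here es p) (i ∷ a) [] _ _ ()
  ⟦⟧-injective {node (c ∷ cs)} (here es p) (i ∷ a) (j ∷ a′) (u , ia∈S) (u′ , ja′∈S) eq
    with proj₁ (∷-injective eq)
  ... | refl with lookupᴱ es i (subF-< (c ∷ cs) i a ia∈S)
  ... | c′ , e , ⟦es⟧≡⟦e⟧ , subF≡sub = cong (i ∷_) (⟦⟧-injective e a a′
          (u , trans (sym (subF≡sub a)) ia∈S) (u′ , trans (sym (subF≡sub a′)) ja′∈S)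
          (trans (sym (⟦es⟧≡⟦e⟧ a)) (trans (proj₂ (∷-injective eq)) (⟦es⟧≡⟦e⟧ a′))))

  ⟦⟧-morphism : ∀ {S K} (e : Emb S K) a a′ → a ∈ᵀ S → a′ ∈ᵀ S → ⟦ e ⟧ (a ∧ a′) ≡ ⟦ e ⟧ a ∧ ⟦ e ⟧ a′
  ⟦⟧-morphism leaf a a′ _ _ = refl
  ⟦⟧-morphism (there i e) a a′ a∈S a′∈S =
    trans (cong (toℕ i ∷_) (⟦⟧-morphism e a a′ a∈S a′∈S)) (sym (∧-∷-≡ (toℕ i) (⟦ e ⟧ a) (⟦ e ⟧ a′)))
  ⟦⟧-morphism (here es p) [] a′ _ _ = refl
  ⟦⟧-morphism (here es p) (i ∷ a) [] _ _ = refl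
  ⟦⟧-morphism {node (c ∷ cs)} (here es p) (i ∷ a) (j ∷ a′) (u , ia∈S) (u′ , ja′∈S) with i ≟ j
  ... | no _ = refl
  ... | yes refl with lookupᴱ es i (subF-< (c ∷ cs) i a ia∈S)
  ... | c′ , e , ⟦es⟧≡⟦e⟧ , subF≡sub = cong (i ∷_) (begin
    ⟦ es ⟧[ i ] (a ∧ a′)                 ≡⟨ ⟦es⟧≡⟦e⟧ (a ∧ a′) ⟩
    ⟦ e ⟧ (a ∧ a′)                       ≡⟨ ⟦⟧-morphism e a a′
                                              (u , trans (sym (subF≡sub a)) ia∈S) (u′ , trans (sym (subF≡sub a′)) ja′∈S) ⟩
    ⟦ e ⟧ a ∧ ⟦ e ⟧ a′                   ≡⟨ sym (cong₂ _∧_ (⟦es⟧≡⟦e⟧ a) (⟦es⟧≡⟦e⟧ a′)) ⟩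
    ⟦ es ⟧[ i ] a ∧ ⟦ es ⟧[ i ] a′       ∎)
    where open ≡-Reasoning

  ⟦⟧-order-preserving : ∀ {S K} (e : Emb S K) a a′ → a ∈ᵀ S → a′ ∈ᵀ S → a ≤ˡ a′ → ⟦ e ⟧ a ≤ˡ ⟦ e ⟧ a′
  ⟦⟧-order-preserving leaf a a′ (_ , a∈S) _ _ rewrite sub-leaf a a∈S = []≤
  ⟦⟧-order-preserving (there i e) a a′ a∈S a′∈S a≤a′ = ≡≤ (⟦⟧-order-preserving e a a′ a∈S a′∈S a≤a′)
  ⟦⟧-order-preserving (here es p) [] a′ _ _ []≤ = []≤
  ⟦⟧-order-preserving (here es p) (i ∷ a) (j ∷ a′) _ _ (<≤ i<j) = <≤ i<j
  ⟦⟧-order-preserving {node (c ∷ cs)} (here es p) (i ∷ a) (.i ∷ a′) (u , ia∈S) (u′ , ia′∈S) (≡≤ a≤a′)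
    with lookupᴱ es i (subF-< (c ∷ cs) i a ia∈S)
  ... | c′ , e , ⟦es⟧≡⟦e⟧ , subF≡sub rewrite ⟦es⟧≡⟦e⟧ a | ⟦es⟧≡⟦e⟧ a′ =
    ≡≤ (⟦⟧-order-preserving e a a′ (u , trans (sym (subF≡sub a)) ia∈S) (u′ , trans (sym (subF≡sub a′)) ia′∈S) a≤a′)

  ⟦⟧-leaf-preserving : ∀ {S K} (e : Emb S K) a → IsLeaf S a → IsLeaf (complete K) (⟦ e ⟧ a)
  ⟦⟧-leaf-preserving leaf a _ = refl
  ⟦⟧-leaf-preserving {K = suc K} (there i e) a leaf-a rewrite sub-complete K i (⟦ e ⟧ a) = ⟦⟧-leaf-preserving e a leaf-a
  ⟦⟧-leaf-preserving (here es p) [] ()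
  ⟦⟧-leaf-preserving {node (c ∷ cs)} {suc K} (here es p) (i ∷ a) leaf-ia with lookupᴱ es i (subF-< (c ∷ cs) i a leaf-ia)
  ... | c′ , e , ⟦es⟧≡⟦e⟧ , subF≡sub rewrite ⟦es⟧≡⟦e⟧ a | subF-replicate b (complete K) i (⟦ e ⟧ a) (child<b i a leaf-ia p) =
    ⟦⟧-leaf-preserving e a (trans (sym (subF≡sub a)) leaf-ia)

  ⟦⟧-initial-segment : ∀ {S K} (e : Emb S K) v → v ∈ᵀ S → ∀ j k → j ≤ k → (⟦ e ⟧ v ∷ʳ k) ∈ᵀ complete K →
    (Σ ℕ λ i → (v ∷ʳ i) ∈ᵀ S × (⟦ e ⟧ v ∷ʳ k) ≼ ⟦ e ⟧ (v ∷ʳ i)) →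
    Σ ℕ λ i → (v ∷ʳ i) ∈ᵀ S × (⟦ e ⟧ v ∷ʳ j) ≼ ⟦ e ⟧ (v ∷ʳ i)
  ⟦⟧-initial-segment leaf v _ j k _ _ (i , (_ , vi∈S) , _) = ⊥-elim (∷ʳ≢[] v i (sub-leaf (v ∷ʳ i) vi∈S))
  ⟦⟧-initial-segment {K = suc K} (there i₀ e) v v∈S j k j≤k (u , vk∈C) (i , vi∈S , below)
    with ⟦⟧-initial-segment e v v∈S j k j≤k (u , trans (sym (sub-complete K i₀ (⟦ e ⟧ v ∷ʳ k))) vk∈C)
                             (i , vi∈S , ≼-∷⁻ below)
  ... | i′ , vi′∈S , below′ = i′ , vi′∈S , ≼-∷⁺ (toℕ i₀) below′
  ⟦⟧-initial-segment {node (c ∷ cs)} (here es p) [] _ j k j≤k _ (i , (_ , i∈S) , (_ , k∷≡i∷)) with ∷-injective k∷≡i∷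
  ... | refl , _ with subF-child (c ∷ cs) j (≤-trans (s≤s j≤k) (subF-< (c ∷ cs) k [] i∈S))
  ... | _ , j∈S = j , (_ , j∈S) , (⟦ es ⟧[ j ] [] , refl)
  ⟦⟧-initial-segment {node (c ∷ cs)} {suc K} (here es p) (i₁ ∷ v) (u , v∈S) j k j≤k (uc , vk∈C) (i , (ui , vi∈S) , below)
    with lookupᴱ es i₁ (subF-< (c ∷ cs) i₁ v v∈S)
  ... | c′ , e , ⟦es⟧≡⟦e⟧ , subF≡sub
    with ⟦⟧-initial-segment e v (u , trans (sym (subF≡sub v)) v∈S) j k j≤k
           (uc , trans (sym (subF-replicate b (complete K) i₁ (⟦ e ⟧ v ∷ʳ k) (child<b i₁ v v∈S p)))
                       (subst (λ w → subF (replicate b (complete K)) i₁ (w ∷ʳ k) ≡ just uc) (⟦es⟧≡⟦e⟧ v) vk∈C))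
           (i , (ui , trans (sym (subF≡sub (v ∷ʳ i))) vi∈S) ,
             subst₂ _≼_ (cong (_∷ʳ k) (⟦es⟧≡⟦e⟧ v)) (⟦es⟧≡⟦e⟧ (v ∷ʳ i)) (≼-∷⁻ below))
  ... | i′ , (ui′ , vi′∈c′) , below′ = i′ , (ui′ , trans (subF≡sub (v ∷ʳ i′)) vi′∈c′) ,
        ≼-∷⁺ i₁ (subst₂ _≼_ (cong (_∷ʳ j) (sym (⟦es⟧≡⟦e⟧ v))) (sym (⟦es⟧≡⟦e⟧ (v ∷ʳ i′))) below′)

  ⟦⟧-isLPEmbedding : ∀ {S K} (e : Emb S K) → IsLPEmbedding S (complete K) ⟦ e ⟧
  ⟦⟧-isLPEmbedding e = record
    { embedding = record
      { maps-to = ⟦⟧-maps-to e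
      ; injective = ⟦⟧-injective e
      ; morphism = ⟦⟧-morphism e
      ; order-preserving = ⟦⟧-order-preserving e
      ; initial-segment = ⟦⟧-initial-segment e
      }
    ; leaf-preserving = ⟦⟧-leaf-preserving e
    }

module Decode (b-1 : ℕ) {S T f} (E : IsLPEmbedding S T f) where

  open Codes b-1
  open Semantics b-1
  open IsLPEmbedding E
  open IsEmbedding embedding

  -- g, read from the node a of S, agrees along f with h, read from the node q of T
  Tracks : Addr → Addr → (Addr → Addr) → (Addr → Addr) → Set
  Tracks a q g h = ∀ x r → (a ++ x) ∈ᵀ S → f (a ++ x) ≡ q ++ r → g x ≡ h r

  tabulateᴱ : ∀ {K} (P : ℕ → (Addr → Addr) → Set) cs →
    (∀ i {c} → subF cs i [] ≡ just c → Σ (Emb c K) λ e → P i ⟦ e ⟧) →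
    Σ (Embs cs K) λ es → ∀ i → i < length cs → P i ⟦ es ⟧[ i ]
  tabulateᴱ P [] _ = [] , λ _ ()
  tabulateᴱ P (c ∷ cs) F with F 0 refl | tabulateᴱ (λ i → P (suc i)) cs (λ i → F (suc i))
  ... | e , Pe | es , Pes = e ∷ es , λ { zero _ → Pe ; (suc i) (s≤s i<n) → Pes i i<n }

  tracks-children : ∀ {K c cs d ds} (es : Embs (c ∷ cs) K) (ts : Embs (d ∷ ds) K) p′ p a q →
    sub S a ≡ just (node (c ∷ cs)) → f a ≡ q →
    (∀ i → i < length (c ∷ cs) → Tracks (a ∷ʳ i) (q ∷ʳ i) ⟦ es ⟧[ i ] ⟦ ts ⟧[ i ]) →
    Tracks a q ⟦ here es p′ ⟧ ⟦ here ts p ⟧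
  tracks-children {c = c} {cs} es ts p′ p a q a↦ fa≡q tracksᵢ [] r _ fa++[]≡q++r =
    cong ⟦ here ts p ⟧ (sym (++-identityʳ-unique q (trans (sym fa≡q) (trans (cong f (sym (++-identityʳ a))) fa++[]≡q++r))))
  tracks-children {c = c} {cs} es ts p′ p a q a↦ fa≡q tracksᵢ (i ∷ x) r aix∈S faix≡q++r
    with subF-< (c ∷ cs) i x (trans (sym (sub-++ S a (i ∷ x) a↦)) (proj₂ aix∈S))
  ... | i<n with ChildAlignment.child-aligned embedding {a} a↦ i i<n
             | embedding-≼ embedding (a ∷ʳ i) x (∷ʳ-∈ᵀ S a a↦ i i<n) (subst (_∈ᵀ S) (++-∷ a i x) aix∈S)
  ... | w , fai≡ | z , fai++z≡faix =
    trans (cong (i ∷_) (tracksᵢ i i<n x (w ++ z) (subst (_∈ᵀ S) (++-∷ a i x) aix∈S) faix≡)) (cong ⟦ here ts p ⟧ (sym r≡))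
    where
    q++iw≡fai : q ++ (i ∷ w) ≡ f (a ∷ʳ i)
    q++iw≡fai = trans (++-∷ q i w) (trans (cong (λ y → (y ∷ʳ i) ++ w) (sym fa≡q)) fai≡)
    r≡ : r ≡ i ∷ (w ++ z)
    r≡ = ++-∷-residual q q++iw≡fai (trans fai++z≡faix (trans (cong f (sym (++-∷ a i x))) faix≡q++r))
    faix≡ : f ((a ∷ʳ i) ++ x) ≡ (q ∷ʳ i) ++ (w ++ z)
    faix≡ = trans (cong f (sym (++-∷ a i x))) (trans faix≡q++r (trans (cong (q ++_) r≡) (++-∷ q i (w ++ z))))

  -- Where t maps the root of T₀ to the root, either f a lies strictly inside
  -- a subtree of q, and e descends into the same subtree, or f a = q, and then e maps the
  -- root to the root since the children of a go below the children of q (child-aligned).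
  mutual
    decode : ∀ K {T₀} (t : Emb T₀ K) {S₀} a q → sub S a ≡ just S₀ → sub T q ≡ just T₀ → q ≼ f a →
      Σ (Emb S₀ K) λ e → Tracks a q ⟦ e ⟧ ⟦ t ⟧
    decode (suc K) (there i t) a q a↦ q↦ q≼fa with decode K t a q a↦ q↦ q≼fa
    ... | e , tracks = there i e , λ x r ax∈S eq → cong (toℕ i ∷_) (tracks x r ax∈S eq)
    decode zero leaf {node []} a q _ _ _ = leaf , λ _ _ _ _ → refl
    decode zero leaf {node (_ ∷ _)} a q a↦ q↦ q≼fa =
      ⊥-elim (a++k∷w≢a a 0 [] (injective (a ∷ʳ 0) a a0∈S a∈S (trans fa0≡q (sym fa≡q))))
      where
      a∈S : a ∈ᵀ S
      a∈S = _ , a↦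
      a0∈S : (a ∷ʳ 0) ∈ᵀ S
      a0∈S = ∷ʳ-∈ᵀ S a a↦ 0 (s≤s z≤n)
      fa≡q : f a ≡ q
      fa≡q = ≼-leaf T q (f a) q↦ q≼fa (maps-to a a∈S)
      fa0≡q : f (a ∷ʳ 0) ≡ q
      fa0≡q = ≼-leaf T q (f (a ∷ʳ 0)) q↦ (≼-trans q≼fa (embedding-≼ embedding a (0 ∷ []) a∈S a0∈S)) (maps-to _ a0∈S)
    decode (suc K) (here ts p) a q a↦ q↦ ([] , q++[]≡fa) =
      decode-root K ts p a q a↦ q↦ (trans (sym q++[]≡fa) (++-identityʳ q))
    decode (suc K) (here ts p) a q a↦ q↦ (k ∷ w , q++kw≡fa) = decode-below K ts p a q k w a↦ q↦ q++kw≡fa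

    decode-below : ∀ K {d ds} (ts : Embs (d ∷ ds) K) (p : length (d ∷ ds) ≤ b) {S₀} a q k w →
      sub S a ≡ just S₀ → sub T q ≡ just (node (d ∷ ds)) → q ++ (k ∷ w) ≡ f a →
      Σ (Emb S₀ (suc K)) λ e → Tracks a q ⟦ e ⟧ ⟦ here ts p ⟧
    decode-below K {d} {ds} ts p a q k w a↦ q↦ q++kw≡fa with maps-to a (_ , a↦)
    ... | u , fa↦ with subF-< (d ∷ ds) k w (trans (sym (sub-++ T q (k ∷ w) q↦)) (subst (λ y → sub T y ≡ just u) (sym q++kw≡fa) fa↦))
    ... | k<n with lookupᴱ ts k k<n
    ... | c′ , tₖ , ⟦ts⟧≡⟦tₖ⟧ , subF≡sub
      with decode K tₖ a (q ∷ʳ k) a↦ (trans (sub-++ T q (k ∷ []) q↦) (subF≡sub [])) (w , trans (sym (++-∷ q k w)) q++kw≡fa)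
    ... | e , tracks = there (fromℕ< (≤-trans k<n p)) e , tracks′
      where
      tracks′ : Tracks a q ⟦ there (fromℕ< (≤-trans k<n p)) e ⟧ ⟦ here ts p ⟧
      tracks′ x r ax∈S fax≡q++r with embedding-≼ embedding a x (_ , a↦) ax∈S
      ... | z , fa++z≡fax = trans
        (cong₂ _∷_ (toℕ-fromℕ< (≤-trans k<n p)) (trans (tracks x (w ++ z) ax∈S fax≡) (sym (⟦ts⟧≡⟦tₖ⟧ (w ++ z)))))
        (cong ⟦ here ts p ⟧ (sym r≡))
        where
        r≡ : r ≡ k ∷ (w ++ z)
        r≡ = ++-∷-residual q q++kw≡fa (trans fa++z≡fax fax≡q++r)
        fax≡ : f (a ++ x) ≡ (q ∷ʳ k) ++ (w ++ z)
        fax≡ = trans fax≡q++r (trans (cong (q ++_) r≡) (++-∷ q k (w ++ z)))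

    decode-root : ∀ K {d ds} (ts : Embs (d ∷ ds) K) (p : length (d ∷ ds) ≤ b) {S₀} a q →
      sub S a ≡ just S₀ → sub T q ≡ just (node (d ∷ ds)) → f a ≡ q →
      Σ (Emb S₀ (suc K)) λ e → Tracks a q ⟦ e ⟧ ⟦ here ts p ⟧
    decode-root K {d} {ds} ts p {node []} a q a↦ q↦ fa≡q = ⊥-elim (inner≢leaf (trans (sym q↦) q↦leaf))
      where
      q↦leaf : sub T q ≡ just (node [])
      q↦leaf = subst (λ y → sub T y ≡ just (node [])) fa≡q (leaf-preserving a a↦)
      inner≢leaf : just (node (d ∷ ds)) ≢ just (node [])
      inner≢leaf ()
    decode-root K {d} {ds} ts p {node (c ∷ cs)} a q a↦ q↦ fa≡q = here es branching , tracks
      where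
      open ChildAlignment embedding {a} a↦
      aligned : ∀ i → i < length (c ∷ cs) → (q ∷ʳ i) ≼ f (a ∷ʳ i)
      aligned i i<n = subst (λ y → (y ∷ʳ i) ≼ f (a ∷ʳ i)) fa≡q (child-aligned i i<n)
      child<T : ∀ i → i < length (c ∷ cs) → i < length (d ∷ ds)
      child<T i i<n = ∷ʳ-∈ᵀ⁻ T q q↦ i (subst (λ y → (y ∷ʳ i) ∈ᵀ T) fa≡q (child-image i i<n))
      branching : length (c ∷ cs) ≤ b
      branching = ≤-trans (child<T (length cs) ≤-refl) p
      child : ∀ i {cᵢ} → subF (c ∷ cs) i [] ≡ just cᵢ →
        Σ (Emb cᵢ K) λ e → Tracks (a ∷ʳ i) (q ∷ʳ i) ⟦ e ⟧ ⟦ ts ⟧[ i ]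
      child i i↦ with subF-< (c ∷ cs) i [] i↦
      ... | i<n with lookupᴱ ts i (child<T i i<n)
      ... | c′ , tᵢ , ⟦ts⟧≡⟦tᵢ⟧ , subF≡sub with decode K tᵢ (a ∷ʳ i) (q ∷ʳ i)
             (trans (sub-++ S a (i ∷ []) a↦) i↦) (trans (sub-++ T q (i ∷ []) q↦) (subF≡sub []))
             (aligned i i<n)
      ... | e , tracksᵢ = e , λ x r ax∈S eq → trans (tracksᵢ x r ax∈S eq) (sym (⟦ts⟧≡⟦tᵢ⟧ r))
      children : Σ (Embs (c ∷ cs) K) λ es → ∀ i → i < length (c ∷ cs) → Tracks (a ∷ʳ i) (q ∷ʳ i) ⟦ es ⟧[ i ] ⟦ ts ⟧[ i ]
      children = tabulateᴱ (λ i g → Tracks (a ∷ʳ i) (q ∷ʳ i) g ⟦ ts ⟧[ i ]) (c ∷ cs) child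
      es : Embs (c ∷ cs) K
      es = proj₁ children
      tracks : Tracks a q ⟦ here es branching ⟧ ⟦ here ts p ⟧
      tracks = tracks-children es ts branching p a q a↦ fa≡q (proj₂ children)

  precompose : ∀ K (t : Emb T K) → Σ (Emb S K) λ e → ∀ x → x ∈ᵀ S → ⟦ e ⟧ x ≡ ⟦ t ⟧ (f x)
  precompose K t with decode K t [] [] refl refl (f [] , refl)
  ... | e , tracks = e , λ x x∈S → tracks x (f x) x∈S refl

module Complete (b-1 : ℕ) where

  open Codes b-1
  open Ramsey b-1
  open Semantics b-1

  mutual
    height : Tree → ℕ
    height (node []) = 0
    height (node (c ∷ cs)) = suc (heightF (c ∷ cs))

    heightF : List Tree → ℕ
    heightF [] = 0
    heightF (c ∷ cs) = height c ⊔ heightF cs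

  mutual
    code : ∀ T → br T ≤ b → Emb T (height T)
    code (node []) _ = leaf
    code (node (c ∷ cs)) br≤b =
      here (codes (c ∷ cs) ≤-refl (≤-trans (m≤n⊔m (length (c ∷ cs)) _) br≤b)) (≤-trans (m≤m⊔n _ (brF (c ∷ cs))) br≤b)

    codes : ∀ cs {H} → heightF cs ≤ H → brF cs ≤ b → Embs cs H
    codes [] _ _ = []
    codes (c ∷ cs) h≤H br≤b = code c (≤-trans (m≤m⊔n _ _) br≤b) · lift (≤-trans (m≤m⊔n _ _) h≤H)
                             ∷ codes cs (≤-trans (m≤n⊔m (height c) _) h≤H) (≤-trans (m≤n⊔m (br c) _) br≤b)

  brF-replicate : ∀ n t → brF (replicate n t) ≤ br t
  brF-replicate zero t = z≤n
  brF-replicate (suc n) t = ⊔-lub ≤-refl (brF-replicate n t)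

  br-complete-≤ : ∀ K → br (complete K) ≤ b
  br-complete-≤ zero = z≤n
  br-complete-≤ (suc K) = ⊔-lub (≤-reflexive (length-replicate b)) (≤-trans (brF-replicate b (complete K)) (br-complete-≤ K))

  br-complete : ∀ K → br (complete (suc K)) ≡ b
  br-complete K = trans (cong (_⊔ brF (replicate b (complete K))) (length-replicate b))
                        (m≥n⇒m⊔n≡m (≤-trans (brF-replicate b (complete K)) (br-complete-≤ K)))

  embedding-ramsey : (S T : Tree) → br T ≡ b → ∀ d →
    Σ Tree λ V → br V ≡ br T ×
      ((c : List Addr → Fin (suc d)) →
        Σ (Addr → Addr) λ g₀ → IsLPEmbedding T V g₀ ×
          Σ (Fin (suc d)) λ k → ∀ f → IsLPEmbedding S T f → c (table S (g₀ ∘ f)) ≡ k)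
  embedding-ramsey S T br≡b d = complete (suc K₀) , trans (br-complete K₀) (sym br≡b) , colour
    where
    t : Emb T (height T)
    t = code T (≤-reflexive br≡b)
    K₀ : ℕ
    K₀ = proj₁ (ramsey S (height T) d)
    colour : (c : List Addr → Fin (suc d)) →
      Σ (Addr → Addr) λ g₀ → IsLPEmbedding T (complete (suc K₀)) g₀ ×
        Σ (Fin (suc d)) λ k → ∀ f → IsLPEmbedding S T f → c (table S (g₀ ∘ f)) ≡ k
    colour c with proj₂ (ramsey S (height T) d) (suc K₀) (n≤1+n K₀) (c ∘ table S ∘ ⟦_⟧)
    ... | G , κ , mono = ⟦ t · G ⟧ , ⟦⟧-isLPEmbedding (t · G) , κ , monochromatic
      where
      monochromatic : ∀ f → IsLPEmbedding S T f → c (table S (⟦ t · G ⟧ ∘ f)) ≡ κ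
      monochromatic f E with Decode.precompose b-1 E (height T) t
      ... | e , e≗t∘f = trans (cong c (table-cong S λ x x∈S → begin
        ⟦ t · G ⟧ (f x)     ≡⟨ ⟦·⟧ t G (f x) (IsEmbedding.maps-to (IsLPEmbedding.embedding E) x x∈S) ⟩
        ⟦ G ⟧ʰ (⟦ t ⟧ (f x)) ≡⟨ cong ⟦ G ⟧ʰ (sym (e≗t∘f x x∈S)) ⟩
        ⟦ G ⟧ʰ (⟦ e ⟧ x)     ≡⟨ sym (⟦·⟧ e G x x∈S) ⟩
        ⟦ e · G ⟧ x         ∎)) (mono e)
        where open ≡-Reasoning

br-positive : ∀ t ts → 0 < br (node (t ∷ ts))
br-positive t ts = ≤-trans (s≤s z≤n) (m≤m⊔n (length (t ∷ ts)) (brF (t ∷ ts)))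

proposition4p1 : (S T : Tree) (d : ℕ) → 0 < d →
    Σ Tree λ V → br V ≡ br T ×
      ((c : List Addr → Fin d) →
        Σ (Addr → Addr) λ g₀ → IsLPEmbedding T V g₀ ×
          Σ (Fin d) λ k → ∀ f → IsLPEmbedding S T f → c (table S (g₀ ∘ f)) ≡ k)
proposition4p1 S (node []) (suc d) _ = node [] , refl , λ c →
  id , id-isLPEmbedding (node []) , c (table S (λ _ → [])) ,
  λ f E → cong c (into-leaf S f (IsLPEmbedding.embedding E))
proposition4p1 S (node (t ∷ ts)) (suc d) _ =
  Complete.embedding-ramsey (pred (br (node (t ∷ ts)))) S (node (t ∷ ts))
    (sym (suc-pred (br (node (t ∷ ts))) {{>-nonZero (br-positive t ts)}})) d
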